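{- The sequence of transpositions in $\mathrm{Sym}(8)$ $$\mathbf e=\langle(0\,1),(0\,3),(1\,2),(1\,3),(2\,3),(2\,4),(3\,4),(3\,7),(4\,5),(4\,7),(5\,6),(5\,7),(6\,7)\rangle$$ is not perm-complete.
   Context: Permutations compose left to right. For a finite sequence $\mathbf s$ in $\mathrm{Sym}(8)$, $\mathrm{Prod}(\mathbf s)$ is the set of products $s_{\psi(0)}\circ\cdots\circ s_{\psi(k-1)}$ over all rearrangements of its terms; $\mathbf s$ is perm-complete iff $\mathrm{Prod}(\mathbf s)$ equals $\mathrm{Alt}(8)$ or $\mathrm{Sym}(8)\setminus\mathrm{Alt}(8)$. -}

module Defs where

open import Data.Nat using (ℕ; zero; suc)
open import Data.Nat.DivMod using (_%_)
open import Data.Fin using (Fin; zero; suc; _<_; _<?_; #_)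
open import Data.Fin.Permutation using (Permutation′; _⟨$⟩ʳ_; _∘ₚ_; id; transpose)
open import Data.List using (List; length; filter; allFin; cartesianProduct)
open import Data.Product using (Σ; _×_; _,_; proj₁; proj₂)
open import Data.Sum using (_⊎_)
open import Relation.Nullary using (¬_)
open import Relation.Nullary.Decidable using (_×-dec_)
open import Relation.Binary.PropositionalEquality using (_≡_)
open import Function using (_∘_; _⇔_)

Sym8 : Set
Sym8 = Permutation′ 8

-- Composition left to right:  (σ ∘ₚ τ) ⟨$⟩ʳ x  =  τ ⟨$⟩ʳ (σ ⟨$⟩ʳ x).
-- Product s₀ ∘ s₁ ∘ ⋯ ∘ s_{k-1} of a finite sequence (empty product = id).
prodSeq : {k : ℕ} → (Fin k → Sym8) → Sym8
prodSeq {zero}  s = id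
prodSeq {suc k} s = s zero ∘ₚ prodSeq (s ∘ suc)

_≈ₚ_ : Sym8 → Sym8 → Set
σ ≈ₚ τ = ∀ x → σ ⟨$⟩ʳ x ≡ τ ⟨$⟩ʳ x

_∈Prod_ : {k : ℕ} → Sym8 → (Fin k → Sym8) → Set
_∈Prod_ {k} σ s = Σ (Permutation′ k) (λ ψ → prodSeq (λ i → s (ψ ⟨$⟩ʳ i)) ≈ₚ σ)

inversions : Sym8 → ℕ
inversions σ =
  length (filter (λ p → (proj₁ p <? proj₂ p) ×-dec ((σ ⟨$⟩ʳ proj₂ p) <? (σ ⟨$⟩ʳ proj₁ p)))
                 (cartesianProduct (allFin 8) (allFin 8)))

InAlt : Sym8 → Set
InAlt σ = inversions σ % 2 ≡ 0

PermComplete : {k : ℕ} → (Fin k → Sym8) → Set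
PermComplete s =
  (∀ σ → (σ ∈Prod s) ⇔ InAlt σ) ⊎ (∀ σ → (σ ∈Prod s) ⇔ (¬ InAlt σ))

e : Fin 13 → Sym8
e zero = transpose (# 0) (# 1)
e (suc zero) = transpose (# 0) (# 3)
e (suc (suc zero)) = transpose (# 1) (# 2)
e (suc (suc (suc zero))) = transpose (# 1) (# 3)
e (suc (suc (suc (suc zero)))) = transpose (# 2) (# 3)
e (suc (suc (suc (suc (suc zero))))) = transpose (# 2) (# 4)
e (suc (suc (suc (suc (suc (suc zero)))))) = transpose (# 3) (# 4)
e (suc (suc (suc (suc (suc (suc (suc zero))))))) = transpose (# 3) (# 7)
e (suc (suc (suc (suc (suc (suc (suc (suc zero)))))))) = transpose (# 4) (# 5)
e (suc (suc (suc (suc (suc (suc (suc (suc (suc zero))))))))) = transpose (# 4) (# 7)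
e (suc (suc (suc (suc (suc (suc (suc (suc (suc (suc zero)))))))))) = transpose (# 5) (# 6)
e (suc (suc (suc (suc (suc (suc (suc (suc (suc (suc (suc zero))))))))))) = transpose (# 5) (# 7)
e (suc (suc (suc (suc (suc (suc (suc (suc (suc (suc (suc (suc zero)))))))))))) = transpose (# 6) (# 7)

module Submission where

-- Split Fin 8 into L = {0,1,2,3} and R = {4,5,6,7}, and let
-- leak π be the number of points of L that π sends into R.  Composing a
-- permutation on the left with a transposition (a b) changes leak by at most 1,
-- and not at all when a and b lie on the same side.  Exactly three terms of e
-- cross between L and R, namely (2 4), (3 4) and (3 7); hence every product of a
-- rearrangement of e has leak ≤ 3.  The odd permutation
--   σ₀ = (0 4)(1 5)(2 6)(3 7)(6 7)
-- has leak 4, so it is not in Prod(e), and Prod(e) is not Sym(8) ∖ Alt(8).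
-- On the other hand Prod(e) contains the product of e in its given order, which
-- is odd (13 transpositions), so Prod(e) is not Alt(8) either.

open import Defs
open import Relation.Nullary using (¬_)
open import Data.Nat using (ℕ; zero; suc; _+_; _≤_; z≤n; s≤s)
open import Data.Nat.Properties
  using (≤-refl; ≤-reflexive; ≤-trans; +-assoc; +-monoʳ-≤; +-monoˡ-≤; +-0-commutativeMonoid; module ≤-Reasoning)
open import Data.Nat.Tactic.RingSolver using (solve-∀)
open import Data.Fin using (Fin; zero; suc; #_)
open import Data.Fin.Permutation using (Permutation′; _⟨$⟩ʳ_; _∘ₚ_; id; transpose)
open import Data.Product using (_,_)
open import Data.Sum using (inj₁; inj₂)
open import Relation.Binary.PropositionalEquality using (_≡_; refl; sym; cong)
open import Function using (_∘_; Equivalence)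
open import Algebra.Properties.CommutativeMonoid.Sum +-0-commutativeMonoid
  using (sum; sum-permute)

prodSeq-bound : (f : Sym8 → ℕ) {k : ℕ} (t : Fin k → Sym8) (w : Fin k → ℕ) →
                (∀ i π → f (t i ∘ₚ π) ≤ w i + f π) →
                f (prodSeq t) ≤ sum w + f id
prodSeq-bound f {zero}  t w step = ≤-refl
prodSeq-bound f {suc k} t w step = begin
  f (t zero ∘ₚ prodSeq (t ∘ suc))    ≤⟨ step zero (prodSeq (t ∘ suc)) ⟩
  w zero + f (prodSeq (t ∘ suc))     ≤⟨ +-monoʳ-≤ (w zero) (prodSeq-bound f (t ∘ suc) (w ∘ suc) (step ∘ suc)) ⟩
  w zero + (sum (w ∘ suc) + f id)    ≡⟨ +-assoc (w zero) (sum (w ∘ suc)) (f id) ⟨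
  sum w + f id                       ∎
  where open ≤-Reasoning

inR : Fin 8 → ℕ
inR zero                   = 0
inR (suc zero)             = 0
inR (suc (suc zero))       = 0
inR (suc (suc (suc zero))) = 0
inR _                      = 1

inR≤1 : ∀ x → inR x ≤ 1
inR≤1 zero                       = z≤n
inR≤1 (suc zero)                 = z≤n
inR≤1 (suc (suc zero))           = z≤n
inR≤1 (suc (suc (suc zero)))     = z≤n
inR≤1 (suc (suc (suc (suc x))))  = ≤-refl

sumL : (Fin 8 → ℕ) → ℕ
sumL g = g (# 0) + g (# 1) + g (# 2) + g (# 3)

lands : Sym8 → Fin 8 → ℕ
lands π x = inR (π ⟨$⟩ʳ x)

leak : Sym8 → ℕ
leak π = sumL (lands π)

leak-resp-≈ₚ : ∀ {σ τ} → σ ≈ₚ τ → leak σ ≡ leak τ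
leak-resp-≈ₚ eq
  rewrite eq (# 0) | eq (# 1) | eq (# 2) | eq (# 3) = refl

-- Reordering the four summands of sumL: a transposition inside L permutes them.
swap₀₁ : ∀ a b c d → b + a + c + d ≡ a + b + c + d
swap₀₁ = solve-∀

swap₀₃ : ∀ a b c d → d + b + c + a ≡ a + b + c + d
swap₀₃ = solve-∀

swap₁₂ : ∀ a b c d → a + c + b + d ≡ a + b + c + d
swap₁₂ = solve-∀

swap₁₃ : ∀ a b c d → a + d + c + b ≡ a + b + c + d
swap₁₃ = solve-∀

swap₂₃ : ∀ a b c d → a + b + d + c ≡ a + b + c + d
swap₂₃ = solve-∀

-- Replacing one summand by a value at most 1: a transposition crossing L and R.
suc-out₂ : ∀ a b c d → a + b + suc c + d ≡ 1 + (a + b + c + d)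
suc-out₂ = solve-∀

suc-out₃ : ∀ a b c d → a + b + c + suc d ≡ 1 + (a + b + c + d)
suc-out₃ = solve-∀

replace₂ : ∀ a b c d y → y ≤ 1 → a + b + y + d ≤ 1 + (a + b + c + d)
replace₂ a b c d y y≤1 =
  ≤-trans (+-monoˡ-≤ d (+-monoʳ-≤ (a + b) (≤-trans y≤1 (s≤s z≤n))))
          (≤-reflexive (suc-out₂ a b c d))

replace₃ : ∀ a b c d y → y ≤ 1 → a + b + c + y ≤ 1 + (a + b + c + d)
replace₃ a b c d y y≤1 =
  ≤-trans (+-monoʳ-≤ (a + b + c) (≤-trans y≤1 (s≤s z≤n)))
          (≤-reflexive (suc-out₃ a b c d))

crossing : Fin 13 → ℕ
crossing (suc (suc (suc (suc (suc zero)))))             = 1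
crossing (suc (suc (suc (suc (suc (suc zero))))))       = 1
crossing (suc (suc (suc (suc (suc (suc (suc zero))))))) = 1
crossing _                                              = 0

module _ (π : Sym8) where
  private
    ℓ : Fin 8 → ℕ
    ℓ = lands π

  leak-step : ∀ i → leak (e i ∘ₚ π) ≤ crossing i + leak π
  -- (0 1), (0 3), (1 2), (1 3), (2 3) permute L, so they only reorder the summands
  leak-step zero = ≤-reflexive (swap₀₁ (ℓ (# 0)) (ℓ (# 1)) (ℓ (# 2)) (ℓ (# 3)))
  leak-step (suc zero) = ≤-reflexive (swap₀₃ (ℓ (# 0)) (ℓ (# 1)) (ℓ (# 2)) (ℓ (# 3)))
  leak-step (suc (suc zero)) = ≤-reflexive (swap₁₂ (ℓ (# 0)) (ℓ (# 1)) (ℓ (# 2)) (ℓ (# 3)))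
  leak-step (suc (suc (suc zero))) = ≤-reflexive (swap₁₃ (ℓ (# 0)) (ℓ (# 1)) (ℓ (# 2)) (ℓ (# 3)))
  leak-step (suc (suc (suc (suc zero)))) = ≤-reflexive (swap₂₃ (ℓ (# 0)) (ℓ (# 1)) (ℓ (# 2)) (ℓ (# 3)))
  -- (2 4), (3 4), (3 7) replace the summand at 2 or 3 by the one at 4 or 7
  leak-step (suc (suc (suc (suc (suc zero))))) = replace₂ (ℓ (# 0)) (ℓ (# 1)) (ℓ (# 2)) (ℓ (# 3)) (ℓ (# 4)) (inR≤1 _)
  leak-step (suc (suc (suc (suc (suc (suc zero)))))) = replace₃ (ℓ (# 0)) (ℓ (# 1)) (ℓ (# 2)) (ℓ (# 3)) (ℓ (# 4)) (inR≤1 _)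
  leak-step (suc (suc (suc (suc (suc (suc (suc zero))))))) = replace₃ (ℓ (# 0)) (ℓ (# 1)) (ℓ (# 2)) (ℓ (# 3)) (ℓ (# 7)) (inR≤1 _)
  -- the remaining transpositions lie inside R and fix L pointwise
  leak-step (suc (suc (suc (suc (suc (suc (suc (suc zero)))))))) = ≤-refl
  leak-step (suc (suc (suc (suc (suc (suc (suc (suc (suc zero))))))))) = ≤-refl
  leak-step (suc (suc (suc (suc (suc (suc (suc (suc (suc (suc zero)))))))))) = ≤-refl
  leak-step (suc (suc (suc (suc (suc (suc (suc (suc (suc (suc (suc zero))))))))))) = ≤-refl
  leak-step (suc (suc (suc (suc (suc (suc (suc (suc (suc (suc (suc (suc zero)))))))))))) = ≤-refl

leak-rearranged : ∀ (ψ : Permutation′ 13) → leak (prodSeq (λ i → e (ψ ⟨$⟩ʳ i))) ≤ 3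
leak-rearranged ψ =
  ≤-trans (prodSeq-bound leak (e ∘ (ψ ⟨$⟩ʳ_)) (crossing ∘ (ψ ⟨$⟩ʳ_)) (λ i π → leak-step π (ψ ⟨$⟩ʳ i)))
          (≤-reflexive (cong (_+ 0) (sym (sum-permute crossing ψ))))

-- σ₀ = (0 4)(1 5)(2 6)(3 7)(6 7) sends all of L into R.
σ₀ : Sym8
σ₀ = transpose (# 0) (# 4) ∘ₚ (transpose (# 1) (# 5) ∘ₚ (transpose (# 2) (# 6)
     ∘ₚ (transpose (# 3) (# 7) ∘ₚ transpose (# 6) (# 7))))

-- σ₀ is a product of five transpositions (checked by counting inversions).
σ₀-odd : ¬ InAlt σ₀
σ₀-odd ()

-- leak σ₀ = 4 (by computation) exceeds the bound of leak-rearranged.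
σ₀∉Prod-e : ¬ (σ₀ ∈Prod e)
σ₀∉Prod-e (ψ , prod≈σ₀) =
  4≰3 (≤-trans (≤-reflexive (sym (leak-resp-≈ₚ {prodSeq (λ i → e (ψ ⟨$⟩ʳ i))} {σ₀} prod≈σ₀)))
               (leak-rearranged ψ))
  where
  4≰3 : ¬ (4 ≤ 3)
  4≰3 (s≤s (s≤s (s≤s ())))

prod-e-odd : ¬ InAlt (prodSeq e)
prod-e-odd ()

proposition2p15 : ¬ PermComplete e
proposition2p15 (inj₁ prod≡alt) =
  prod-e-odd (Equivalence.to (prod≡alt (prodSeq e)) (id , λ _ → refl))
proposition2p15 (inj₂ prod≡odd) =
  σ₀∉Prod-e (Equivalence.from (prod≡odd σ₀) σ₀-odd)
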